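{- For clauses $A\subseteq B$ of width at most $w$, the inequality $M(A)-M(B)\ge0$ has a derivation in Sherali-Adams resolution (SAR) of rank $w+1$ and size $O(w^2)$.
   Context: Variables are $x_1,\dots,x_n$ and twins $\bar x_1,\dots,\bar x_n$, treated as independent real variables. For disjoint sets of variables $Y,Z$ let $M(Y,Z)=\prod_{y\in Y}\bar y\prod_{z\in Z}z$. For a clause $C=\bigvee_{y\in V^+}y\lor\bigvee_{z\in V^- }\bar z$ (with $V^+$, $V^-$ the variables occurring positively, resp. negatively), $M(C)=M(V^+,V^-)$. The width of a clause is its number of literals. An SAR derivation of $r\ge0$ (from a possibly empty set of premises $q_1\ge0,\dots,q_m\ge0$) is an expression $\sum_{t=1}^{\tau}\alpha_t\prod_{i\in I_t}x_i\prod_{j\in J_t}(1-x_j)\,p_t$, where the products range over variables from $\{x_1,\dots,x_n,\bar x_1,\dots,\bar x_n\}$, $\alpha_t\ge0$ are reals, and each $p_t$ is one of the $q_j$, an axiom $x^2-x$ or $x-x^2$ (for any such variable), a complementarity axiom $1-x_i-\bar x_i$ or $-1+x_i+\bar x_i$, or the constant $1$, and which expands to $r$. Its rank is the maximum degree of the polynomials to which the summands expand, and its size is the sum of their numbers of terms. -}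

module Defs where

open import Data.Nat as ℕ using (ℕ; zero; suc; _≤_)
open import Data.Fin as Fin using (Fin)
open import Data.Vec as Vec using (Vec; []; _∷_)
import Data.Vec.Properties as VecP
open import Data.List as List using (List; []; _∷_; _++_; length)
open import Data.List.Relation.Unary.All using (All)
open import Data.Maybe using (Maybe; just; nothing)
open import Data.Bool using (Bool; true; false; if_then_else_)
open import Data.Product using (Σ; _×_; _,_)
open import Data.Unit using (⊤)
open import Data.Rational as ℚ using (ℚ; 0ℚ; 1ℚ)
open import Relation.Nullary using (yes; no; ¬_)
open import Relation.Nullary.Decidable using (⌊_⌋)
open import Relation.Binary.PropositionalEquality using (_≡_)

-- Variables x_1..x_n and their twins x̄_1..x̄_n (independent variables)

data Var (n : ℕ) : Set where
  x  : Fin n → Var n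
  x̄  : Fin n → Var n

-- Formal (not multilinearised) polynomials with rational coefficients
-- in the 2n variables.  A monomial is an exponent vector for the x's
-- together with an exponent vector for the x̄'s.

Monomial : ℕ → Set
Monomial n = Vec ℕ n × Vec ℕ n

Poly : ℕ → Set
Poly n = List (ℚ × Monomial n)

sameMon : ∀ {n} → Monomial n → Monomial n → Bool
sameMon (a , b) (c , d) =
  ⌊ VecP.≡-dec ℕ._≟_ a c ⌋ Data.Bool.∧ ⌊ VecP.≡-dec ℕ._≟_ b d ⌋
  where import Data.Bool

coeff : ∀ {n} → Poly n → Monomial n → ℚ
coeff [] m = 0ℚ
coeff ((a , m') ∷ p) m = (if sameMon m' m then a else 0ℚ) ℚ.+ coeff p m

_≈_ : ∀ {n} → Poly n → Poly n → Set
p ≈ q = ∀ m → coeff p m ≡ coeff q m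

mon1 : ∀ {n} → Monomial n
mon1 = Vec.replicate _ 0 , Vec.replicate _ 0

monMul : ∀ {n} → Monomial n → Monomial n → Monomial n
monMul (a , b) (c , d) = Vec.zipWith ℕ._+_ a c , Vec.zipWith ℕ._+_ b d

monDeg : ∀ {n} → Monomial n → ℕ
monDeg (a , b) = Vec.sum a ℕ.+ Vec.sum b

unitVec : ∀ {n} → Fin n → Vec ℕ n
unitVec i = Vec.tabulate (λ j → if ⌊ i Fin.≟ j ⌋ then 1 else 0)

varMon : ∀ {n} → Var n → Monomial n
varMon (x i) = unitVec i , Vec.replicate _ 0
varMon (x̄ i) = Vec.replicate _ 0 , unitVec i

const : ∀ {n} → ℚ → Poly n
const a = (a , mon1) ∷ []

var : ∀ {n} → Var n → Poly n
var v = (1ℚ , varMon v) ∷ []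

_⊕_ : ∀ {n} → Poly n → Poly n → Poly n
p ⊕ q = p ++ q

neg : ∀ {n} → Poly n → Poly n
neg = List.map (λ { (a , m) → (ℚ.- a , m) })

_⊖_ : ∀ {n} → Poly n → Poly n → Poly n
p ⊖ q = p ⊕ neg q

_⊗_ : ∀ {n} → Poly n → Poly n → Poly n
p ⊗ q = List.concatMap (λ { (a , m) → List.map (λ { (b , m') → (a ℚ.* b , monMul m m') }) q }) p

prod : ∀ {n} → List (Poly n) → Poly n
prod = List.foldr _⊗_ (const 1ℚ)

-- Sherali-Adams resolution (SAR), derivations from the empty premise set

data Axiom (n : ℕ) : Set where
  sqAx     : Var n → Axiom n
  negSqAx  : Var n → Axiom n
  complAx  : Fin n → Axiom n
  negComplAx : Fin n → Axiom n
  oneAx    : Axiom n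

axiomPoly : ∀ {n} → Axiom n → Poly n
axiomPoly (sqAx v)      = (var v ⊗ var v) ⊖ var v
axiomPoly (negSqAx v)   = var v ⊖ (var v ⊗ var v)
axiomPoly (complAx i)   = (const 1ℚ ⊖ var (x i)) ⊖ var (x̄ i)
axiomPoly (negComplAx i) = (const (ℚ.- 1ℚ) ⊕ var (x i)) ⊕ var (x̄ i)
axiomPoly oneAx         = const 1ℚ

record Summand (n : ℕ) : Set where
  field
    α      : ℚ
    α≥0    : 0ℚ ℚ.≤ α
    I      : List (Var n)
    J      : List (Var n)
    factor : Axiom n

summandPoly : ∀ {n} → Summand n → Poly n
summandPoly s =
  ((const α ⊗ prod (List.map var I)) ⊗ prod (List.map (λ v → const 1ℚ ⊖ var v) J))
    ⊗ axiomPoly factor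
  where open Summand s

Derivation : ℕ → Set
Derivation n = List (Summand n)

derivPoly : ∀ {n} → Derivation n → Poly n
derivPoly = List.foldr (λ s acc → summandPoly s ⊕ acc) []

Derives : ∀ {n} → Derivation n → Poly n → Set
Derives D r = derivPoly D ≈ r

-- the polynomial p expands to a polynomial with at most k terms, each of
-- degree at most d (equivalently: its normal form has ≤ k nonzero
-- monomials and degree ≤ d)
TermsDeg≤ : ∀ {n} → Poly n → ℕ → ℕ → Set
TermsDeg≤ p k d =
  Σ (Poly _) λ L → length L ≤ k × All (λ t → monDeg (Data.Product.proj₂ t) ≤ d) L × L ≈ p
  where import Data.Product

SizeRank≤ : ∀ {n} → Derivation n → ℕ → ℕ → Set
SizeRank≤ [] S d = ⊤
SizeRank≤ (s ∷ D) S d =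
  Σ ℕ λ k → Σ ℕ λ S' → (k ℕ.+ S' ≤ S) × TermsDeg≤ (summandPoly s) k d × SizeRank≤ D S' d

-- Clauses: for each variable, absent (nothing), positive (just true)
-- or negative (just false).  (No complementary pair can occur.)

Clause : ℕ → Set
Clause n = Vec (Maybe Bool) n

width : ∀ {n} → Clause n → ℕ
width [] = 0
width (nothing ∷ C) = width C
width (just _ ∷ C) = suc (width C)

_⊆_ : ∀ {n} → Clause n → Clause n → Set
A ⊆ B = ∀ i b → Vec.lookup A i ≡ just b → Vec.lookup B i ≡ just b

M : ∀ {n} → Clause n → Poly n
M C = (1ℚ , (Vec.map xExp C , Vec.map x̄Exp C)) ∷ []
  where
  xExp : Maybe Bool → ℕ
  xExp (just false) = 1
  xExp _ = 0
  x̄Exp : Maybe Bool → ℕ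
  x̄Exp (just true) = 1
  x̄Exp _ = 0

module Submission where

-- For clauses A ⊆ B put Δ = B ∖ A.  Then M(B) = M(A) · ∏_{u ∈ Δ} u, and
-- listing Δ as u₁,…,u_k with L₀ = M(A), L_{t} = u_t · L_{t-1}, we have the
-- telescoping identity
--
--   M(A) − M(B) = Σ_{t=1}^{k} (L_{t-1} − L_t) = Σ_{t=1}^{k} L_{t-1} · (1 − u_t),
--
-- where every summand L_{t-1} · (1 − u_t) · 1 is an SAR summand with I the
-- variables of L_{t-1}, J = {u_t} and the factor 1.  Each summand expands to
-- two monomials of degree at most w + 1, so the derivation has rank w + 1
-- and size 2k ≤ 2w ≤ 2(w² + 1).

open import Defs
open import Data.Nat using (ℕ; suc; _+_; _*_; _≤_)
open import Data.Product using (Σ; _×_)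

import Data.Nat as ℕ
import Data.Nat.Properties as ℕP
open import Algebra.Properties.CommutativeSemigroup ℕP.+-commutativeSemigroup
  using (interchange)
open import Data.Fin as Fin using (Fin)
open import Data.Vec as Vec using (Vec; []; _∷_)
import Data.Vec.Properties as VecP
open import Data.List as List using (List; []; _∷_; length)
import Data.List.Properties as ListP
open import Data.List.Relation.Unary.All using ([]; _∷_)
open import Data.Maybe using (just; nothing)
open import Data.Bool using (true; false; if_then_else_)
open import Data.Product using (_,_)
open import Data.Unit using (tt)
open import Data.Rational as ℚ using (1ℚ)
import Data.Rational.Properties as ℚP
open import Relation.Nullary using (yes; no)
open import Relation.Nullary.Decidable using (⌊_⌋)
open import Relation.Binary.PropositionalEquality

private
  variable
    n : ℕ

monMul-identityˡ : (m : Monomial n) → monMul mon1 m ≡ m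
monMul-identityˡ (a , b) =
  cong₂ _,_ (VecP.zipWith-identityˡ ℕP.+-identityˡ a) (VecP.zipWith-identityˡ ℕP.+-identityˡ b)

monMul-identityʳ : (m : Monomial n) → monMul m mon1 ≡ m
monMul-identityʳ (a , b) =
  cong₂ _,_ (VecP.zipWith-identityʳ ℕP.+-identityʳ a) (VecP.zipWith-identityʳ ℕP.+-identityʳ b)

monMul-comm : (m m' : Monomial n) → monMul m m' ≡ monMul m' m
monMul-comm (a , b) (c , d) =
  cong₂ _,_ (VecP.zipWith-comm ℕP.+-comm a c) (VecP.zipWith-comm ℕP.+-comm b d)

monMul-assoc : (m m' m'' : Monomial n) → monMul (monMul m m') m'' ≡ monMul m (monMul m' m'')
monMul-assoc (a , b) (c , d) (e , f) =
  cong₂ _,_ (VecP.zipWith-assoc ℕP.+-assoc a c e) (VecP.zipWith-assoc ℕP.+-assoc b d f)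

sum-zipWith-+ : (a b : Vec ℕ n) → Vec.sum (Vec.zipWith _+_ a b) ≡ Vec.sum a + Vec.sum b
sum-zipWith-+ [] [] = refl
sum-zipWith-+ (i ∷ a) (j ∷ b) =
  trans (cong (i + j +_) (sum-zipWith-+ a b)) (interchange i j (Vec.sum a) (Vec.sum b))

monDeg-monMul : (m m' : Monomial n) → monDeg (monMul m m') ≡ monDeg m + monDeg m'
monDeg-monMul (a , b) (c , d) =
  trans (cong₂ _+_ (sum-zipWith-+ a c) (sum-zipWith-+ b d))
        (interchange (Vec.sum a) (Vec.sum c) (Vec.sum b) (Vec.sum d))

sum-replicate-0 : ∀ k → Vec.sum (Vec.replicate k 0) ≡ 0
sum-replicate-0 ℕ.zero = refl
sum-replicate-0 (suc k) = sum-replicate-0 k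

tabulate-0 : ∀ k → Vec.tabulate {n = k} (λ _ → 0) ≡ Vec.replicate k 0
tabulate-0 ℕ.zero = refl
tabulate-0 (suc k) = cong (0 ∷_) (tabulate-0 k)

unitVec-zero : unitVec {suc n} Fin.zero ≡ 1 ∷ Vec.replicate n 0
unitVec-zero {n} = cong (1 ∷_) (tabulate-0 n)

unitVec-suc : (i : Fin n) → unitVec (Fin.suc i) ≡ 0 ∷ unitVec i
unitVec-suc i = cong (0 ∷_) (VecP.tabulate-cong λ j → cong (λ b → if b then 1 else 0) (≟-suc j))
  where
  ≟-suc : ∀ j → ⌊ Fin.suc i Fin.≟ Fin.suc j ⌋ ≡ ⌊ i Fin.≟ j ⌋
  ≟-suc j with i Fin.≟ j
  ... | yes _ = refl
  ... | no _ = refl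

sum-unitVec : (i : Fin n) → Vec.sum (unitVec i) ≡ 1
sum-unitVec {suc n} Fin.zero = trans (cong Vec.sum (unitVec-zero {n})) (cong suc (sum-replicate-0 n))
sum-unitVec (Fin.suc i) = trans (cong Vec.sum (unitVec-suc i)) (sum-unitVec i)

monDeg-varMon : (v : Var n) → monDeg (varMon v) ≡ 1
monDeg-varMon {n} (x i) = cong₂ _+_ (sum-unitVec i) (sum-replicate-0 n)
monDeg-varMon {n} (x̄ i) = cong₂ _+_ (sum-replicate-0 n) (sum-unitVec i)

varsMon : List (Var n) → Monomial n
varsMon [] = mon1
varsMon (v ∷ L) = monMul (varMon v) (varsMon L)

monDeg-varsMon : (L : List (Var n)) → monDeg (varsMon L) ≡ length L
monDeg-varsMon {n} [] = cong₂ _+_ (sum-replicate-0 n) (sum-replicate-0 n)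
monDeg-varsMon (v ∷ L) =
  trans (monDeg-monMul (varMon v) (varsMon L)) (cong₂ _+_ (monDeg-varMon v) (monDeg-varsMon L))

prod-vars : (L : List (Var n)) → prod (List.map var L) ≡ (1ℚ , varsMon L) ∷ []
prod-vars [] = refl
prod-vars (v ∷ L) = cong (var v ⊗_) (prod-vars L)

liftVar : Var n → Var (suc n)
liftVar (x i) = x (Fin.suc i)
liftVar (x̄ i) = x̄ (Fin.suc i)

consMon : ℕ → ℕ → Monomial n → Monomial (suc n)
consMon p q (a , b) = p ∷ a , q ∷ b

varMon-lift : (v : Var n) → varMon (liftVar v) ≡ consMon 0 0 (varMon v)
varMon-lift (x i) = cong (λ a → a , 0 ∷ Vec.replicate _ 0) (unitVec-suc i)
varMon-lift (x̄ i) = cong (λ b → 0 ∷ Vec.replicate _ 0 , b) (unitVec-suc i)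

varsMon-lift : (L : List (Var n)) → varsMon (List.map liftVar L) ≡ consMon 0 0 (varsMon L)
varsMon-lift [] = refl
varsMon-lift (v ∷ L) = cong₂ monMul (varMon-lift v) (varsMon-lift L)

-- Clauses.  clauseMon C is the monomial of the one-term polynomial M(C),
-- read off its first term; thus M C ≡ (1 , clauseMon C) ∷ [] holds
-- definitionally.

firstMon : Poly n → Monomial n
firstMon [] = mon1
firstMon ((_ , m) ∷ _) = m

clauseMon : Clause n → Monomial n
clauseMon C = firstMon (M C)

clauseVars : Clause n → List (Var n)
clauseVars [] = []
clauseVars (nothing ∷ C) = List.map liftVar (clauseVars C)
clauseVars (just true ∷ C) = x̄ Fin.zero ∷ List.map liftVar (clauseVars C)
clauseVars (just false ∷ C) = x Fin.zero ∷ List.map liftVar (clauseVars C)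

length-clauseVars : (C : Clause n) → length (clauseVars C) ≡ width C
length-clauseVars [] = refl
length-clauseVars (nothing ∷ C) = trans (ListP.length-map liftVar (clauseVars C)) (length-clauseVars C)
length-clauseVars (just true ∷ C) = cong suc (trans (ListP.length-map liftVar (clauseVars C)) (length-clauseVars C))
length-clauseVars (just false ∷ C) = cong suc (trans (ListP.length-map liftVar (clauseVars C)) (length-clauseVars C))

varMon-x̄₀ : varMon (x̄ {suc n} Fin.zero) ≡ consMon 0 1 mon1
varMon-x̄₀ = cong (λ b → Vec.replicate _ 0 , b) unitVec-zero

varMon-x₀ : varMon (x {suc n} Fin.zero) ≡ consMon 1 0 mon1
varMon-x₀ = cong (λ a → a , Vec.replicate _ 0) unitVec-zero

varsMon-clauseVars : (C : Clause n) → varsMon (clauseVars C) ≡ clauseMon C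
varsMon-clauseVars [] = refl
varsMon-clauseVars (nothing ∷ C) =
  trans (varsMon-lift (clauseVars C)) (cong (consMon 0 0) (varsMon-clauseVars C))
varsMon-clauseVars (just true ∷ C) =
  trans (cong₂ monMul varMon-x̄₀ (varsMon-lift (clauseVars C)))
        (cong (consMon 0 1) (trans (monMul-identityˡ _) (varsMon-clauseVars C)))
varsMon-clauseVars (just false ∷ C) =
  trans (cong₂ monMul varMon-x₀ (varsMon-lift (clauseVars C)))
        (cong (consMon 1 0) (trans (monMul-identityˡ _) (varsMon-clauseVars C)))

_∖_ : Clause n → Clause n → Clause n
[] ∖ [] = []
(b ∷ B) ∖ (nothing ∷ A) = b ∷ (B ∖ A)
(b ∷ B) ∖ (just _ ∷ A) = nothing ∷ (B ∖ A)

⊆-tail : ∀ {a b} {A B : Clause n} → (a ∷ A) ⊆ (b ∷ B) → A ⊆ B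
⊆-tail A⊆B i = A⊆B (Fin.suc i)

clauseMon-∖ : (A B : Clause n) → A ⊆ B → monMul (clauseMon (B ∖ A)) (clauseMon A) ≡ clauseMon B
clauseMon-∖ [] [] _ = refl
clauseMon-∖ (nothing ∷ A) (nothing ∷ B) A⊆B = cong (consMon 0 0) (clauseMon-∖ A B (⊆-tail A⊆B))
clauseMon-∖ (nothing ∷ A) (just true ∷ B) A⊆B = cong (consMon 0 1) (clauseMon-∖ A B (⊆-tail A⊆B))
clauseMon-∖ (nothing ∷ A) (just false ∷ B) A⊆B = cong (consMon 1 0) (clauseMon-∖ A B (⊆-tail A⊆B))
clauseMon-∖ (just s ∷ A) (b ∷ B) A⊆B with A⊆B Fin.zero s refl
clauseMon-∖ (just true ∷ A) (just true ∷ B) A⊆B | refl = cong (consMon 0 1) (clauseMon-∖ A B (⊆-tail A⊆B))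
clauseMon-∖ (just false ∷ A) (just false ∷ B) A⊆B | refl = cong (consMon 1 0) (clauseMon-∖ A B (⊆-tail A⊆B))

width-∖ : (A B : Clause n) → A ⊆ B → width (B ∖ A) + width A ≡ width B
width-∖ [] [] _ = refl
width-∖ (nothing ∷ A) (nothing ∷ B) A⊆B = width-∖ A B (⊆-tail A⊆B)
width-∖ (nothing ∷ A) (just _ ∷ B) A⊆B = cong suc (width-∖ A B (⊆-tail A⊆B))
width-∖ (just s ∷ A) (b ∷ B) A⊆B with A⊆B Fin.zero s refl
... | refl = trans (ℕP.+-suc _ _) (cong suc (width-∖ A B (⊆-tail A⊆B)))

binom : Monomial n → Monomial n → Poly n
binom m₁ m₂ = (1ℚ , m₁) ∷ (ℚ.- 1ℚ , m₂) ∷ []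

coeff-⊕ : (p q : Poly n) (m : Monomial n) → coeff (p ⊕ q) m ≡ coeff p m ℚ.+ coeff q m
coeff-⊕ [] q m = sym (ℚP.+-identityˡ _)
coeff-⊕ ((a , m') ∷ p) q m =
  trans (cong (c ℚ.+_) (coeff-⊕ p q m)) (sym (ℚP.+-assoc c (coeff p m) (coeff q m)))
  where c = if sameMon m' m then a else _

-- (a − b) + (b − c) = a − c; each coefficient is a closed rational
-- computation once it is known which of a, b, c equal the monomial asked for.
binom-telescope : (a b c : Monomial n) → (binom a b ⊕ binom b c) ≈ binom a c
binom-telescope a b c m with sameMon a m | sameMon b m | sameMon c m
... | true  | true  | true  = refl
... | true  | true  | false = refl
... | true  | false | true  = refl
... | true  | false | false = refl
... | false | true  | true  = refl
... | false | true  | false = refl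
... | false | false | true  = refl
... | false | false | false = refl

binom-self : (a : Monomial n) → [] ≈ binom a a
binom-self a m with sameMon a m
... | true  = refl
... | false = refl

peel : List (Var n) → Var n → Summand n
peel L u = record
  { α = 1ℚ ; α≥0 = ℚP.nonNegative⁻¹ 1ℚ ; I = L ; J = u ∷ [] ; factor = oneAx }

summandPoly-peel : (L : List (Var n)) (u : Var n) →
  summandPoly (peel L u) ≡ binom (varsMon L) (varsMon (u ∷ L))
summandPoly-peel L u =
  trans (cong (λ p → ((const 1ℚ ⊗ p) ⊗ prod (List.map (λ v → const 1ℚ ⊖ var v) (u ∷ []))) ⊗ const 1ℚ)
              (prod-vars L))
        (cong₂ binom first second)
  where
  open ≡-Reasoning
  first : monMul (monMul (monMul mon1 (varsMon L)) (monMul mon1 mon1)) mon1 ≡ varsMon L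
  first = begin
    monMul (monMul (monMul mon1 (varsMon L)) (monMul mon1 mon1)) mon1
      ≡⟨ monMul-identityʳ _ ⟩
    monMul (monMul mon1 (varsMon L)) (monMul mon1 mon1)
      ≡⟨ cong₂ monMul (monMul-identityˡ (varsMon L)) (monMul-identityˡ mon1) ⟩
    monMul (varsMon L) mon1
      ≡⟨ monMul-identityʳ (varsMon L) ⟩
    varsMon L ∎
  second : monMul (monMul (monMul mon1 (varsMon L)) (monMul (varMon u) mon1)) mon1 ≡ varsMon (u ∷ L)
  second = begin
    monMul (monMul (monMul mon1 (varsMon L)) (monMul (varMon u) mon1)) mon1
      ≡⟨ monMul-identityʳ _ ⟩
    monMul (monMul mon1 (varsMon L)) (monMul (varMon u) mon1)
      ≡⟨ cong₂ monMul (monMul-identityˡ (varsMon L)) (monMul-identityʳ (varMon u)) ⟩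
    monMul (varsMon L) (varMon u)
      ≡⟨ monMul-comm (varsMon L) (varMon u) ⟩
    varsMon (u ∷ L) ∎

peelChain : List (Var n) → List (Var n) → Derivation n
peelChain L [] = []
peelChain L (u ∷ E) = peel L u ∷ peelChain (u ∷ L) E

peelChain-derives : (L E : List (Var n)) →
  Derives (peelChain L E) (binom (varsMon L) (monMul (varsMon E) (varsMon L)))
peelChain-derives L [] m =
  trans (binom-self (varsMon L) m) (cong (λ m' → coeff (binom (varsMon L) m') m) (sym (monMul-identityˡ (varsMon L))))
peelChain-derives L (u ∷ E) m = begin
  coeff (summandPoly (peel L u) ⊕ derivPoly (peelChain (u ∷ L) E)) m
    ≡⟨ coeff-⊕ (summandPoly (peel L u)) (derivPoly (peelChain (u ∷ L) E)) m ⟩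
  coeff (summandPoly (peel L u)) m ℚ.+ coeff (derivPoly (peelChain (u ∷ L) E)) m
    ≡⟨ cong₂ ℚ._+_ (cong (λ p → coeff p m) (summandPoly-peel L u)) (peelChain-derives (u ∷ L) E m) ⟩
  coeff (binom (varsMon L) (varsMon (u ∷ L))) m ℚ.+ coeff (binom (varsMon (u ∷ L)) end) m
    ≡⟨ coeff-⊕ (binom (varsMon L) (varsMon (u ∷ L))) (binom (varsMon (u ∷ L)) end) m ⟨
  coeff (binom (varsMon L) (varsMon (u ∷ L)) ⊕ binom (varsMon (u ∷ L)) end) m
    ≡⟨ binom-telescope (varsMon L) (varsMon (u ∷ L)) end m ⟩
  coeff (binom (varsMon L) end) m
    ≡⟨ cong (λ m' → coeff (binom (varsMon L) m') m) shift ⟩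
  coeff (binom (varsMon L) (monMul (varsMon (u ∷ E)) (varsMon L))) m ∎
  where
  open ≡-Reasoning
  end : Monomial _
  end = monMul (varsMon E) (varsMon (u ∷ L))
  shift : end ≡ monMul (varsMon (u ∷ E)) (varsMon L)
  shift = begin
    monMul (varsMon E) (monMul (varMon u) (varsMon L))
      ≡⟨ monMul-assoc (varsMon E) (varMon u) (varsMon L) ⟨
    monMul (monMul (varsMon E) (varMon u)) (varsMon L)
      ≡⟨ cong (λ m → monMul m (varsMon L)) (monMul-comm (varsMon E) (varMon u)) ⟩
    monMul (varsMon (u ∷ E)) (varsMon L) ∎

SizeRank≤-mono : (D : Derivation n) {S S' d : ℕ} → SizeRank≤ D S d → S ≤ S' → SizeRank≤ D S' d
SizeRank≤-mono [] _ _ = tt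
SizeRank≤-mono (s ∷ D) (k , S'' , k+S''≤S , terms , rest) S≤S' =
  k , S'' , ℕP.≤-trans k+S''≤S S≤S' , terms , rest

peelChain-sizeRank : (w : ℕ) (L E : List (Var n)) → length L + length E ≤ w →
  SizeRank≤ (peelChain L E) (2 * length E) (suc w)
peelChain-sizeRank w L [] _ = tt
peelChain-sizeRank w L (u ∷ E) |L|+|uE|≤w =
  2 , 2 * length E , size , terms , peelChain-sizeRank w (u ∷ L) E |uL|+|E|≤w
  where
  |uL|+|E|≤w : suc (length L) + length E ≤ w
  |uL|+|E|≤w = subst (_≤ w) (ℕP.+-suc (length L) (length E)) |L|+|uE|≤w
  |L|≤w : length L ≤ w
  |L|≤w = ℕP.≤-trans (ℕP.m≤m+n (length L) (suc (length E))) |L|+|uE|≤w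
  size : 2 + 2 * length E ≤ 2 * length (u ∷ E)
  size = ℕP.≤-reflexive (sym (ℕP.*-distribˡ-+ 2 1 (length E)))
  terms : TermsDeg≤ (summandPoly (peel L u)) 2 (suc w)
  terms = binom (varsMon L) (varsMon (u ∷ L)) , ℕP.≤-refl
        , subst (_≤ suc w) (sym (monDeg-varsMon L)) (ℕP.m≤n⇒m≤1+n |L|≤w)
        ∷ subst (_≤ suc w) (sym (monDeg-varsMon (u ∷ L))) (ℕ.s≤s |L|≤w)
        ∷ []
        , λ m → cong (λ p → coeff p m) (sym (summandPoly-peel L u))

weakening : (A B : Clause n) → A ⊆ B →
  Derives (peelChain (clauseVars A) (clauseVars (B ∖ A))) (M A ⊖ M B)
weakening A B A⊆B m = trans (peelChain-derives (clauseVars A) (clauseVars (B ∖ A)) m)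
  (cong (λ p → coeff p m) (cong₂ binom (varsMon-clauseVars A) product))
  where
  open ≡-Reasoning
  product : monMul (varsMon (clauseVars (B ∖ A))) (varsMon (clauseVars A)) ≡ clauseMon B
  product = begin
    monMul (varsMon (clauseVars (B ∖ A))) (varsMon (clauseVars A))
      ≡⟨ cong₂ monMul (varsMon-clauseVars (B ∖ A)) (varsMon-clauseVars A) ⟩
    monMul (clauseMon (B ∖ A)) (clauseMon A)
      ≡⟨ clauseMon-∖ A B A⊆B ⟩
    clauseMon B ∎

weakening-sizeRank : (w : ℕ) (A B : Clause n) → A ⊆ B → width B ≤ w →
  SizeRank≤ (peelChain (clauseVars A) (clauseVars (B ∖ A))) (2 * w) (suc w)
weakening-sizeRank w A B A⊆B |B|≤w =
  SizeRank≤-mono (peelChain (clauseVars A) (clauseVars (B ∖ A)))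
    (peelChain-sizeRank w (clauseVars A) (clauseVars (B ∖ A)) |A|+|Δ|≤w)
    (ℕP.*-monoʳ-≤ 2 |Δ|≤w)
  where
  |A|+|Δ|≡|B| : length (clauseVars A) + length (clauseVars (B ∖ A)) ≡ width B
  |A|+|Δ|≡|B| = trans (cong₂ _+_ (length-clauseVars A) (length-clauseVars (B ∖ A)))
                     (trans (ℕP.+-comm (width A) (width (B ∖ A))) (width-∖ A B A⊆B))
  |A|+|Δ|≤w : length (clauseVars A) + length (clauseVars (B ∖ A)) ≤ w
  |A|+|Δ|≤w = subst (_≤ w) (sym |A|+|Δ|≡|B|) |B|≤w
  |Δ|≤w : length (clauseVars (B ∖ A)) ≤ w
  |Δ|≤w = ℕP.≤-trans (ℕP.m≤n+m _ (length (clauseVars A))) |A|+|Δ|≤w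

-- w ≤ w² + 1, so size 2w is within the constant c = 2 of O(w² + 1).
w≤w*w+1 : ∀ w → w ≤ w * w + 1
w≤w*w+1 ℕ.zero = ℕ.z≤n
w≤w*w+1 w@(suc _) = ℕP.≤-trans (ℕP.m≤m*n w w) (ℕP.m≤m+n (w * w) 1)

lemma4p3 : Σ ℕ λ c → ∀ (n w : ℕ) (A B : Clause n) → A ⊆ B → width A ≤ w → width B ≤ w →
    Σ (Derivation n) λ D → Derives D (M A ⊖ M B) × SizeRank≤ D (c * (w * w + 1)) (suc w)
lemma4p3 = 2 , λ n w A B A⊆B _ |B|≤w →
  peelChain (clauseVars A) (clauseVars (B ∖ A)) ,
  weakening A B A⊆B ,
  SizeRank≤-mono (peelChain (clauseVars A) (clauseVars (B ∖ A)))
    (weakening-sizeRank w A B A⊆B |B|≤w) (ℕP.*-monoʳ-≤ 2 (w≤w*w+1 w))
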